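{- Let $D$ be a positive integer and let $G$ be an outerplanar graph with a connected component $C$ such that $r^+(C)<D/2$. Then $G$ has a diameter-$D$ outerplanar completion if and only if $G\setminus C$ does.
   Context: For a graph $G=(V,E)$, an outerplanar completion of $G$ is a graph $G'=(V,E\cup F)$, for some set $F$ of pairs of vertices non-adjacent in $G$, such that $G'$ is outerplanar; it is a diameter-$D$ outerplanar completion if it has diameter at most $D$. For a connected graph $C$ and integer $D$, let $C'$ be $C$ plus a new isolated vertex $v$; the escalated eccentricity $r^+(C)$ is the minimum of $\max_{z}\operatorname{dist}_{C^*}(v,z)$ over all diameter-$D$ outerplanar completions $C^*$ of $C'$, and $r^+(C)=\infty$ if no such completion exists. -}

module Defs where

open import Data.Nat using (ℕ; zero; suc; _+_; _*_; _≤_; _<_)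
open import Data.Fin using (Fin)
open import Data.Bool using (Bool; true; false)
open import Data.Maybe using (Maybe; just; nothing)
open import Data.Product using (Σ; ∃; ∃-syntax; _×_; _,_)
open import Relation.Binary.PropositionalEquality using (_≡_)
open import Relation.Nullary using (¬_)
open import Function.Base using (_∘_)
open import Data.Bool using (not)

record Graph (V : Set) : Set where
  field
    adj    : V → V → Bool
    adj-sym : ∀ u v → adj u v ≡ adj v u
    adj-irr : ∀ u → adj u u ≡ false
open Graph public

Edge : {V : Set} → Graph V → V → V → Set
Edge G u v = adj G u v ≡ true

data Walk {V : Set} (G : Graph V) : V → V → ℕ → Set where
  here : ∀ {u} → Walk G u u zero
  step : ∀ {u w v k} → Edge G u w → Walk G w v k → Walk G u v (suc k)

DistAtMost : {V : Set} → Graph V → V → V → ℕ → Set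
DistAtMost G u v k = Σ ℕ λ l → l ≤ k × Walk G u v l

-- diameter ≤ D (a disconnected graph has infinite diameter)
DiameterAtMost : {V : Set} → Graph V → ℕ → Set
DiameterAtMost G D = ∀ u v → DistAtMost G u v D

-- Outerplanarity: vertices placed in convex position (injectively, in order
-- along a circle given by pos), edges drawn as chords, no two chords cross.
-- Chords {a,b},{c,d} cross iff their endpoints interleave a < c < b < d.
Outerplanar : {V : Set} → Graph V → Set
Outerplanar {V} G =
  Σ (V → ℕ) λ pos →
    (∀ u v → pos u ≡ pos v → u ≡ v) ×
    (∀ a b c d → Edge G a b → Edge G c d →
       ¬ (pos a < pos c × pos c < pos b × pos b < pos d))

IsCompletion : {V : Set} → Graph V → Graph V → Set
IsCompletion G G' = ∀ u v → Edge G u v → Edge G' u v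

IsDiamOPCompletion : {V : Set} → ℕ → Graph V → Graph V → Set
IsDiamOPCompletion D G G' = IsCompletion G G' × Outerplanar G' × DiameterAtMost G' D

HasDiamOPCompletion : {V : Set} → ℕ → Graph V → Set
HasDiamOPCompletion {V} D G = Σ (Graph V) λ G' → IsDiamOPCompletion D G G'

IsComponent : {n : ℕ} → Graph (Fin n) → (Fin n → Bool) → Set
IsComponent {n} G S =
  (Σ (Fin n) λ v → S v ≡ true) ×
  (∀ u v → S u ≡ true → S v ≡ true → Σ ℕ λ k → Walk G u v k) ×
  (∀ u v → Edge G u v → S u ≡ true → S v ≡ true)

InducedOn : {V : Set} → Graph V → (S : V → Bool) → (b : Bool) →
            Graph (Σ V λ v → S v ≡ b)
InducedOn G S b = record
  { adj = λ u v → adj G (proj u) (proj v)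
  ; adj-sym = λ u v → adj-sym G (proj u) (proj v)
  ; adj-irr = λ u → adj-irr G (proj u) }
  where
    proj : (Σ _ λ v → S v ≡ b) → _
    proj (v , _) = v

-- C' = C plus a new isolated vertex (nothing)
addIsolated : {V : Set} → Graph V → Graph (Maybe V)
addIsolated G = record { adj = a ; adj-sym = s ; adj-irr = i }
  where
    a : Maybe _ → Maybe _ → Bool
    a (just u) (just v) = adj G u v
    a _ _ = false
    s : ∀ u v → a u v ≡ a v u
    s (just u) (just v) = adj-sym G u v
    s (just u) nothing = _≡_.refl
    s nothing (just v) = _≡_.refl
    s nothing nothing = _≡_.refl
    i : ∀ u → a u u ≡ false
    i (just u) = adj-irr G u
    i nothing = _≡_.refl

-- r⁺(C) ≤ r : some diameter-D outerplanar completion C* of C' has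
-- eccentricity of the new vertex at most r.
EscEccAtMost : {V : Set} → ℕ → Graph V → ℕ → Set
EscEccAtMost {V} D C r =
  Σ (Graph (Maybe V)) λ C* →
    IsDiamOPCompletion D (addIsolated C) C* ×
    (∀ z → DistAtMost C* nothing z r)

-- r⁺(C) < D/2   (with r⁺(C) = ∞ if no completion exists; since r⁺ is a
-- minimum of natural numbers, this holds iff some attained value r has 2r < D)
EscEccLtHalf : {V : Set} → ℕ → Graph V → Set
EscEccLtHalf D C = Σ ℕ λ r → 2 * r < D × EscEccAtMost D C r

module Submission where

-- In a diameter-D outerplanar completion of G, contract C onto the endpoint
-- outside C of an edge leaving C.  Contraction does not increase distances, and since C is
-- connected, its vertices lie on the same side as that endpoint of every chord between the
-- remaining vertices, so the inherited cyclic order stays non-crossing.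
--
-- Every outerplanar graph of diameter at most 2K + 1 has an outerplanar
-- completion, in the same cyclic order, with a vertex w of eccentricity at most K + 1.  For
-- K + 1 = D - r with r = r⁺(C) < D/2 this applies to a completion of G ∖ C.  Gluing an optimal
-- completion C* of C + v onto it by identifying v with w keeps it outerplanar, and every vertex
-- of C is within r of w, so paths between the two sides have length at most r + (D - r) = D.
-- If G ∖ C is empty, contract v onto one of its neighbours instead.

open import Defs
open import Axiom.UniquenessOfIdentityProofs.WithK using (uip)
open import Data.Bool using (Bool; true; false)
import Data.Bool.Properties as Bool
open import Data.Empty using (⊥; ⊥-elim)
open import Data.Unit using (⊤; tt)
open import Data.Fin using (Fin)
import Data.Fin.Properties as Fin
open import Data.Maybe using (Maybe; just; nothing)
open import Data.Nat using (ℕ; zero; suc; _+_; _*_; _∸_; _≤_; _<_; _≤?_; _<?_; z≤n; s≤s; _⊔_)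
open import Data.Nat.Properties
open import Data.Product using (Σ; ∃; ∃₂; _×_; _,_; proj₁; proj₂)
open import Data.Sum using (_⊎_; inj₁; inj₂; [_,_]′)
import Data.Sum as Sum
open import Function.Base using (_∘_; id; case_of_)
open import Function.Bundles using (mk⇔)
open import Relation.Binary.Definitions using (DecidableEquality; tri<; tri≈; tri>)
open import Relation.Binary.PropositionalEquality
open import Relation.Nullary using (¬_; Dec; yes; no; does; ¬?; _×-dec_; _⊎-dec_; map′)
open import Relation.Nullary.Decidable using (dec-true; dec-false; does-⇔)
open import Relation.Unary using (Decidable)

-- Walks and distances

true≢false : true ≢ false
true≢false ()

true-or-false : (b : Bool) → b ≡ true ⊎ b ≡ false
true-or-false true  = inj₁ refl
true-or-false false = inj₂ refl

module _ {V : Set} {G : Graph V} where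

  edge-sym : ∀ {u v} → Edge G u v → Edge G v u
  edge-sym {u} {v} e = trans (adj-sym G v u) e

  edge-irrefl : ∀ {u v} → Edge G u v → u ≢ v
  edge-irrefl {u} e refl with trans (sym e) (adj-irr G u)
  ... | ()

  edge? : ∀ u v → Dec (Edge G u v)
  edge? u v = adj G u v Bool.≟ true

  _++ʷ_ : ∀ {u v w k l} → Walk G u v k → Walk G v w l → Walk G u w (k + l)
  here     ++ʷ q = q
  step e p ++ʷ q = step e (p ++ʷ q)

  reverseʷ : ∀ {u v k} → Walk G u v k → Walk G v u k
  reverseʷ here = here
  reverseʷ {k = suc k} (step e p) =
    subst (Walk G _ _) (+-comm k 1) (reverseʷ p ++ʷ step (edge-sym e) here)

  walk-first-edge : ∀ {u v k} → Walk G u v k → u ≢ v → ∃ λ w → Edge G u w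
  walk-first-edge here       u≢u = ⊥-elim (u≢u refl)
  walk-first-edge (step e _) _   = _ , e

  walk-exit : (S : V → Bool) → ∀ {u v k} → Walk G u v k → S u ≡ true → S v ≡ false →
              ∃₂ λ x y → S x ≡ true × S y ≡ false × Edge G x y
  walk-exit S here Su Sv = ⊥-elim (true≢false (trans (sym Su) Sv))
  walk-exit S (step {w = w} e p) Su Sv with true-or-false (S w)
  ... | inj₁ Sw = walk-exit S p Sw Sv
  ... | inj₂ Sw = _ , w , Su , Sw , e

  dist-refl : ∀ {u k} → DistAtMost G u u k
  dist-refl = 0 , z≤n , here

  dist-sym : ∀ {u v k} → DistAtMost G u v k → DistAtMost G v u k
  dist-sym (l , l≤k , p) = l , l≤k , reverseʷ p

  dist-trans : ∀ {u v w k m} → DistAtMost G u v k → DistAtMost G v w m → DistAtMost G u w (k + m)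
  dist-trans (l , l≤k , p) (l′ , l′≤m , q) = l + l′ , +-mono-≤ l≤k l′≤m , p ++ʷ q

  dist-mono : ∀ {u v k m} → k ≤ m → DistAtMost G u v k → DistAtMost G u v m
  dist-mono k≤m (l , l≤k , p) = l , ≤-trans l≤k k≤m , p

  dist-step : ∀ {u v w k} → Edge G u v → DistAtMost G v w k → DistAtMost G u w (suc k)
  dist-step e (l , l≤k , p) = suc l , s≤s l≤k , step e p

Hom : {V W : Set} → Graph V → Graph W → (V → W) → Set
Hom G H f = ∀ {x y} → Edge G x y → Edge H (f x) (f y)

module _ {V W : Set} {G : Graph V} {H : Graph W} {f : V → W} (hom : Hom G H f) where

  walk-hom : ∀ {u v k} → Walk G u v k → Walk H (f u) (f v) k
  walk-hom here       = here
  walk-hom (step e p) = step (hom e) (walk-hom p)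

  dist-hom : ∀ {u v k} → DistAtMost G u v k → DistAtMost H (f u) (f v) k
  dist-hom (l , l≤k , p) = l , l≤k , walk-hom p

completion-dist : {V : Set} {G H : Graph V} → IsCompletion G H →
                  ∀ {u v k} → DistAtMost G u v k → DistAtMost H u v k
completion-dist G⊆H = dist-hom λ {x} {y} → G⊆H x y

diameter-completion : {V : Set} {G H : Graph V} → IsCompletion G H → ∀ {D} → DiameterAtMost G D → DiameterAtMost H D
diameter-completion G⊆H diam u v = completion-dist G⊆H (diam u v)

diameter-mono : {V : Set} {G : Graph V} {D D′ : ℕ} → D ≤ D′ → DiameterAtMost G D → DiameterAtMost G D′
diameter-mono D≤D′ diam u v = dist-mono D≤D′ (diam u v)

completion-refl : {V : Set} {G : Graph V} → IsCompletion G G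
completion-refl _ _ e = e

completion-trans : {V : Set} {G H K : Graph V} → IsCompletion G H → IsCompletion H K → IsCompletion G K
completion-trans G⊆H H⊆K x y = H⊆K x y ∘ G⊆H x y

Searchable : Set → Set₁
Searchable V = {P : V → Set} → Decidable P → Dec (∃ P)

Bounded : Set → Set
Bounded V = (f : V → ℕ) → ∃ λ b → ∀ x → f x < b

searchable-Maybe : {A : Set} → Searchable A → Searchable (Maybe A)
searchable-Maybe search P? with P? nothing | search (P? ∘ just)
... | yes p | _           = yes (nothing , p)
... | no _  | yes (a , p) = yes (just a , p)
... | no ¬p | no ¬q       = no λ { (nothing , p) → ¬p p ; (just a , p) → ¬q (a , p) }

searchable-⊎ : {A B : Set} → Searchable A → Searchable B → Searchable (A ⊎ B)
searchable-⊎ searchA searchB P? with searchA (P? ∘ inj₁) | searchB (P? ∘ inj₂)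
... | yes (a , p) | _           = yes (inj₁ a , p)
... | no _        | yes (b , p) = yes (inj₂ b , p)
... | no ¬p       | no ¬q       = no λ { (inj₁ a , p) → ¬p (a , p) ; (inj₂ b , p) → ¬q (b , p) }

searchable-fibre : {A : Set} → Searchable A → (f : A → Bool) (b : Bool) → Searchable (Σ A λ a → f a ≡ b)
searchable-fibre search f b {P} P? with search in-fibre?
  where
    in-fibre? : ∀ a → Dec (Σ (f a ≡ b) λ e → P (a , e))
    in-fibre? a with f a Bool.≟ b
    ... | no fa≢b = no (fa≢b ∘ proj₁)
    ... | yes e   = map′ (e ,_) (λ { (e′ , p) → subst (λ e → P (a , e)) (uip e′ e) p }) (P? (a , e))
... | yes (a , e , p) = yes ((a , e) , p)
... | no none         = no λ { ((a , e) , p) → none (a , e , p) }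

bounded-Fin : ∀ {n} → Bounded (Fin n)
bounded-Fin {zero}  f = 0 , λ ()
bounded-Fin {suc n} f with bounded-Fin (f ∘ Fin.suc)
... | b , f∘suc<b = suc (f Fin.zero) ⊔ b , λ
  { Fin.zero    → m≤m⊔n (suc (f Fin.zero)) b
  ; (Fin.suc i) → <-≤-trans (f∘suc<b i) (m≤n⊔m (suc (f Fin.zero)) b) }

bounded-Maybe : {A : Set} → Bounded A → Bounded (Maybe A)
bounded-Maybe bounded f with bounded (f ∘ just)
... | b , f∘just<b = suc (f nothing) ⊔ b , λ
  { nothing  → m≤m⊔n (suc (f nothing)) b
  ; (just a) → <-≤-trans (f∘just<b a) (m≤n⊔m (suc (f nothing)) b) }

bounded-fibre : {A : Set} → Bounded A → (f : A → Bool) (b : Bool) → Bounded (Σ A λ a → f a ≡ b)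
bounded-fibre {A} bounded f b g =
  proj₁ bound , λ { (a , e) → ≤-<-trans (g≤extend a e (f a Bool.≟ b)) (proj₂ bound a) }
  where
    extend : ∀ a → Dec (f a ≡ b) → ℕ
    extend a (yes e) = g (a , e)
    extend a (no _)  = 0

    bound : ∃ λ c → ∀ a → extend a (f a Bool.≟ b) < c
    bound = bounded λ a → extend a (f a Bool.≟ b)

    g≤extend : ∀ a e (fa≡b? : Dec (f a ≡ b)) → g (a , e) ≤ extend a fa≡b?
    g≤extend a e (yes e′) rewrite uip e e′ = ≤-refl
    g≤extend a e (no fa≢b) = ⊥-elim (fa≢b e)

module Extremum {V : Set} (search : Searchable V) {P : V → Set} (P? : Decidable P) where

  private
    descend : (key : V → ℕ) → ∀ fuel x → key x < fuel → P x →
              ∃ λ s → P s × ∀ y → P y → key s ≤ key y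
    descend key (suc fuel) x kx<fuel px with search (λ y → P? y ×-dec key y <? key x)
    ... | yes (y , py , ky<kx) = descend key fuel y (<-≤-trans ky<kx (≤-pred kx<fuel)) py
    ... | no none              = x , px , λ y py → ≮⇒≥ λ ky<kx → none (y , py , ky<kx)

  minimal : (key : V → ℕ) → ∀ {x} → P x → ∃ λ s → P s × ∀ y → P y → key s ≤ key y
  minimal key {x} = descend key (suc (key x)) x ≤-refl

  maximal : (key : V → ℕ) → ∀ {b} → (∀ x → key x < b) → ∀ {x} → P x →
            ∃ λ s → P s × ∀ y → P y → key y ≤ key s
  maximal key {b} key<b px with minimal (λ x → b ∸ key x) px
  ... | s , ps , min = s , ps , λ y py → ≮⇒≥ λ ks<ky → <⇒≱ (∸-monoʳ-< ks<ky (<⇒≤ (key<b y))) (min y py)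

module _ {V : Set} (search : Searchable V) (_≟_ : DecidableEquality V) (G : Graph V) where

  dist? : ∀ k x y → Dec (DistAtMost G x y k)
  dist? zero x y with x ≟ y
  ... | yes refl = yes dist-refl
  ... | no x≢y   = no λ { (zero , _ , here) → x≢y refl }
  dist? (suc k) x y with x ≟ y | search (λ z → edge? {G = G} x z ×-dec dist? k z y)
  ... | yes refl | _              = yes dist-refl
  ... | no _     | yes (z , e , d) = yes (dist-step e d)
  ... | no x≢y   | no none         = no λ
    { (zero , _ , here)             → x≢y refl
    ; (suc l , s≤s l≤k , step e p) → none (_ , e , l , l≤k , p) }

-- Non-crossing vertex orders

-- With these, Outerplanar G unfolds to Σ pos (Injective pos × NonCrossing G pos).

Injective : {A B : Set} → (A → B) → Set
Injective f = ∀ x y → f x ≡ f y → x ≡ y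

Crossing : {V : Set} → (V → ℕ) → V → V → V → V → Set
Crossing pos a b c d = pos a < pos c × pos c < pos b × pos b < pos d

NonCrossing : {V : Set} → Graph V → (V → ℕ) → Set
NonCrossing G pos = ∀ a b c d → Edge G a b → Edge G c d → ¬ Crossing pos a b c d

Inside : {V : Set} → (V → ℕ) → V → V → V → Set
Inside pos a b x = pos a < pos x × pos x < pos b

nonCrossing-resp : {V : Set} {G : Graph V} {pos pos′ : V → ℕ} → (∀ x → pos x ≡ pos′ x) →
                   NonCrossing G pos → NonCrossing G pos′
nonCrossing-resp {pos = pos} {pos′} pos≗pos′ nc a b c d ab cd (a<c , c<b , b<d) =
  nc a b c d ab cd (lift a c a<c , lift c b c<b , lift b d b<d)
  where
    lift : ∀ x y → pos′ x < pos′ y → pos x < pos y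
    lift x y = subst₂ _<_ (sym (pos≗pos′ x)) (sym (pos≗pos′ y))

pos<⇒≢ : {V : Set} {pos : V → ℕ} {x y : V} → pos x < pos y → x ≢ y
pos<⇒≢ x<y refl = <-irrefl refl x<y

inside-edge : {V : Set} {G : Graph V} {pos : V → ℕ} → Injective pos → NonCrossing G pos →
              ∀ {c d x y} → Edge G c d → Inside pos c d x → Edge G x y → y ≢ c → y ≢ d → Inside pos c d y
inside-edge {G = G} {pos} pos-inj nc {c} {d} {x} {y} cd (c<x , x<d) xy y≢c y≢d with <-cmp (pos y) (pos c)
... | tri< y<c _ _ = ⊥-elim (nc y x c d (edge-sym {G = G} xy) cd (y<c , c<x , x<d))
... | tri≈ _ y≡c _ = ⊥-elim (y≢c (pos-inj y c y≡c))
... | tri> _ _ c<y with <-cmp (pos y) (pos d)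
...   | tri< y<d _ _ = c<y , y<d
...   | tri≈ _ y≡d _ = ⊥-elim (y≢d (pos-inj y d y≡d))
...   | tri> _ _ d<y = ⊥-elim (nc c d x y cd xy (c<x , x<d , d<y))

does⇒ : {A : Set} (a? : Dec A) → does a? ≡ true → A
does⇒ (yes a) _ = a

module RelationGraph {V : Set} {R : V → V → Set} (R? : ∀ x y → Dec (R x y))
  (R-sym : ∀ {x y} → R x y → R y x) (R-irrefl : ∀ {x} → ¬ R x x) where

  graph : Graph V
  graph = record
    { adj     = λ x y → does (R? x y)
    ; adj-sym = λ x y → does-⇔ (mk⇔ R-sym R-sym) (R? x y) (R? y x)
    ; adj-irr = λ x → dec-false (R? x x) R-irrefl }

  edge⁺ : ∀ {x y} → R x y → Edge graph x y
  edge⁺ {x} {y} = dec-true (R? x y)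

  edge⁻ : ∀ {x y} → Edge graph x y → R x y
  edge⁻ {x} {y} = does⇒ (R? x y)

module Image {V W : Set} (search : Searchable V) (_≟_ : DecidableEquality W) (K : Graph V) (f : V → W) where

  Joins : W → W → Set
  Joins a b = ∃₂ λ x y → Edge K x y × f x ≡ a × f y ≡ b

  private
    Joined : W → W → Set
    Joined a b = a ≢ b × Joins a b

    joined? : ∀ a b → Dec (Joined a b)
    joined? a b = ¬? (a ≟ b) ×-dec search λ x → search λ y → edge? {G = K} x y ×-dec f x ≟ a ×-dec f y ≟ b

    joined-sym : ∀ {a b} → Joined a b → Joined b a
    joined-sym (a≢b , x , y , e , refl , refl) = ≢-sym a≢b , y , x , edge-sym {G = K} e , refl , refl

    module G = RelationGraph joined? joined-sym (λ a≢a → proj₁ a≢a refl)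
    open G using (edge⁺; edge⁻)

  image : Graph W
  image = G.graph

  image⁺ : ∀ {x y} → Edge K x y → f x ≢ f y → Edge image (f x) (f y)
  image⁺ e fx≢fy = edge⁺ (fx≢fy , _ , _ , e , refl , refl)

  image⁻ : ∀ {a b} → Edge image a b → Joins a b
  image⁻ = proj₂ ∘ edge⁻

  image-walk : ∀ {x y k} → Walk K x y k → DistAtMost image (f x) (f y) k
  image-walk here = dist-refl
  image-walk (step {u} {w} e p) with f u ≟ f w
  ... | yes fu≡fw = dist-mono (n≤1+n _) (subst (λ a → DistAtMost image a (f _) _) (sym fu≡fw) (image-walk p))
  ... | no fu≢fw  = dist-step (image⁺ e fu≢fw) (image-walk p)

  image-dist : ∀ {x y k} → DistAtMost K x y k → DistAtMost image (f x) (f y) k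
  image-dist (l , l≤k , p) = dist-mono l≤k (image-walk p)

  image-nonCrossing : ∀ {pos : W → ℕ} → NonCrossing K (pos ∘ f) → NonCrossing image pos
  image-nonCrossing nc a b c d ab cd cr with image⁻ ab | image⁻ cd
  ... | x , y , xy , refl , refl | z , t , zt , refl , refl = nc x y z t xy zt cr

module AddEdge {V : Set} (_≟_ : DecidableEquality V) (H : Graph V) {p q : V} (p≢q : p ≢ q) where

  Link : V → V → Set
  Link x y = Edge H x y ⊎ (x ≡ p × y ≡ q) ⊎ (x ≡ q × y ≡ p)

  private
    link? : ∀ x y → Dec (Link x y)
    link? x y = edge? {G = H} x y ⊎-dec (x ≟ p ×-dec y ≟ q) ⊎-dec (x ≟ q ×-dec y ≟ p)

    link-sym : ∀ {x y} → Link x y → Link y x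
    link-sym (inj₁ e)                  = inj₁ (edge-sym {G = H} e)
    link-sym (inj₂ (inj₁ (x≡p , y≡q))) = inj₂ (inj₂ (y≡q , x≡p))
    link-sym (inj₂ (inj₂ (x≡q , y≡p))) = inj₂ (inj₁ (y≡p , x≡q))

    link-irrefl : ∀ {x} → ¬ Link x x
    link-irrefl (inj₁ e)                  = edge-irrefl {G = H} e refl
    link-irrefl (inj₂ (inj₁ (refl , p≡q))) = p≢q p≡q
    link-irrefl (inj₂ (inj₂ (refl , q≡p))) = p≢q (sym q≡p)

    module G = RelationGraph link? link-sym link-irrefl
    open G using (edge⁺; edge⁻)

  graph : Graph V
  graph = G.graph

  completion : IsCompletion H graph
  completion x y e = edge⁺ (inj₁ e)

  added : Edge graph p q
  added = edge⁺ (inj₂ (inj₁ (refl , refl)))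

  module _ {pos : V → ℕ} (nc : NonCrossing H pos) (p<q : pos p < pos q)
    (free : ∀ x y → Edge H x y → ¬ Crossing pos p q x y)
    (free′ : ∀ x y → Edge H x y → ¬ Crossing pos x y p q) where

    nonCrossing : NonCrossing graph pos
    nonCrossing a b c d ab cd cr@(a<c , c<b , b<d) with edge⁻ ab | edge⁻ cd
    ... | inj₁ ab′ | inj₁ cd′ = nc a b c d ab′ cd′ cr
    ... | inj₁ ab′ | inj₂ (inj₁ (refl , refl)) = free′ a b ab′ cr
    ... | inj₁ _   | inj₂ (inj₂ (refl , refl)) = <-asym p<q (<-trans c<b b<d)
    ... | inj₂ (inj₁ (refl , refl)) | inj₁ cd′ = free c d cd′ cr
    ... | inj₂ (inj₂ (refl , refl)) | inj₁ _   = <-asym p<q (<-trans a<c c<b)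
    ... | inj₂ (inj₁ (refl , refl)) | inj₂ (inj₁ (refl , refl)) = <-irrefl refl a<c
    ... | inj₂ (inj₁ (refl , refl)) | inj₂ (inj₂ (refl , refl)) = <-irrefl refl c<b
    ... | inj₂ (inj₂ (refl , refl)) | inj₂ (inj₁ (refl , refl)) = <-irrefl refl c<b
    ... | inj₂ (inj₂ (refl , refl)) | inj₂ (inj₂ (refl , refl)) = <-irrefl refl a<c

_⊕_ : {A B : Set} → Graph A → Graph B → Graph (A ⊎ B)
_⊕_ {A} {B} G H = record { adj = adj⊕ ; adj-sym = sym⊕ ; adj-irr = irr⊕ }
  where
    adj⊕ : A ⊎ B → A ⊎ B → Bool
    adj⊕ (inj₁ a) (inj₁ a′) = adj G a a′
    adj⊕ (inj₂ b) (inj₂ b′) = adj H b b′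
    adj⊕ _        _         = false

    sym⊕ : ∀ x y → adj⊕ x y ≡ adj⊕ y x
    sym⊕ (inj₁ a) (inj₁ a′) = adj-sym G a a′
    sym⊕ (inj₂ b) (inj₂ b′) = adj-sym H b b′
    sym⊕ (inj₁ _) (inj₂ _)  = refl
    sym⊕ (inj₂ _) (inj₁ _)  = refl

    irr⊕ : ∀ x → adj⊕ x x ≡ false
    irr⊕ (inj₁ a) = adj-irr G a
    irr⊕ (inj₂ b) = adj-irr H b

-- Contraction

-- φ contracts the vertices off the image of ι onto u.  Each of them reaches ι u through such
-- vertices, so it lies on the same side as ι u of every chord avoiding u; this keeps the
-- order pos ∘ ι non-crossing.

module Contraction {V W : Set} (search : Searchable V) (_≟_ : DecidableEquality W) (K : Graph V)
  {pos : V → ℕ} (pos-inj : Injective pos) (nc : NonCrossing K pos)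
  (ι : W → V) (φ : V → W) (φι : ∀ a → φ (ι a) ≡ a) (u : W) where

  OffImage : V → Set
  OffImage x = ∀ a → ι a ≢ x

  data Reaches : V → Set where
    arrived : Reaches (ι u)
    via     : ∀ {x y} → OffImage x → Edge K x y → Reaches y → Reaches x

  ι-injective : Injective ι
  ι-injective a c ιa≡ιc = trans (sym (φι a)) (trans (cong φ ιa≡ιc) (φι c))

  ι≢ : ∀ {a c} → a ≢ c → ι a ≢ ι c
  ι≢ a≢c = a≢c ∘ ι-injective _ _

  φ≢⇒≢ι : ∀ {x c} → φ x ≢ c → x ≢ ι c
  φ≢⇒≢ι {c = c} φx≢c refl = φx≢c (φι c)

  open Image search _≟_ K φ public using (image)
  open Image search _≟_ K φ using (image⁺; image⁻; image-dist)

  module _ (retract : ∀ x → ι (φ x) ≡ x ⊎ (φ x ≡ u × Reaches x)) where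

    image-edge-ι : ∀ {a b} → Edge image a b → a ≢ u → b ≢ u → Edge K (ι a) (ι b)
    image-edge-ι ab a≢u b≢u with image⁻ ab
    ... | x , y , xy , refl , refl = subst₂ (Edge K) (sym (ι∘φ x a≢u)) (sym (ι∘φ y b≢u)) xy
      where
        ι∘φ : ∀ z → φ z ≢ u → ι (φ z) ≡ z
        ι∘φ z φz≢u with retract z
        ... | inj₁ ιφz≡z     = ιφz≡z
        ... | inj₂ (φz≡u , _) = ⊥-elim (φz≢u φz≡u)

    module _ {c d : W} (cd : Edge image c d) (c≢u : c ≢ u) (d≢u : d ≢ u) where

      private
        In : V → Set
        In = Inside pos (ι c) (ι d)

        step-inside : ∀ {x y} → In x → Edge K x y → y ≢ ι c → y ≢ ι d → In y
        step-inside = inside-edge {G = K} pos-inj nc (image-edge-ι cd c≢u d≢u)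

        reaches-≢ : ∀ {x e} → Reaches x → e ≢ u → x ≢ ι e
        reaches-≢ arrived       e≢u = ι≢ (≢-sym e≢u)
        reaches-≢ (via off _ _) _   = ≢-sym (off _)

        reaches-inside : ∀ {x} → Reaches x → In (ι u) → In x
        reaches-inside arrived        i = i
        reaches-inside (via off xy r) i =
          step-inside (reaches-inside r i) (edge-sym {G = K} xy) (≢-sym (off c)) (≢-sym (off d))

        inside-reaches : ∀ {x} → Reaches x → In x → In (ι u)
        inside-reaches arrived      i = i
        inside-reaches (via _ xy r) i = inside-reaches r (step-inside i xy (reaches-≢ r c≢u) (reaches-≢ r d≢u))

        retract-inside : ∀ x → In (ι (φ x)) → In x
        retract-inside x i with retract x
        ... | inj₁ ιφx≡x      = subst In ιφx≡x i
        ... | inj₂ (refl , r) = reaches-inside r i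

        inside-retract : ∀ x → In x → In (ι (φ x))
        inside-retract x i with retract x
        ... | inj₁ ιφx≡x      = subst In (sym ιφx≡x) i
        ... | inj₂ (refl , r) = inside-reaches r i

      image-inside-edge : ∀ {s t} → Inside (pos ∘ ι) c d s → Edge image s t → t ≢ c → t ≢ d →
                          Inside (pos ∘ ι) c d t
      image-inside-edge i st t≢c t≢d with image⁻ st
      ... | x , y , xy , refl , refl =
        inside-retract y (step-inside (retract-inside x i) xy (φ≢⇒≢ι t≢c) (φ≢⇒≢ι t≢d))

    -- Of two crossing edges, one avoids u and is a chord of K; the other would leave its inside.
    contraction-nonCrossing : NonCrossing image (pos ∘ ι)
    contraction-nonCrossing a b c d ab cd (a<c , c<b , b<d) with <-trans a<c (<-trans c<b b<d) | a ≟ u | b ≟ u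
    ... | a<d | no a≢u | no b≢u =
      <-asym b<d (proj₂ (image-inside-edge ab a≢u b≢u (a<c , c<b) cd
                           (≢-sym (pos<⇒≢ a<d)) (≢-sym (pos<⇒≢ b<d))))
    ... | a<d | yes refl | _ =
      <-asym a<c (proj₁ (image-inside-edge cd (≢-sym (pos<⇒≢ a<c)) (≢-sym (pos<⇒≢ a<d))
                           (c<b , b<d) (edge-sym {G = image} ab) (pos<⇒≢ a<c) (pos<⇒≢ a<d)))
    ... | a<d | no _ | yes refl =
      <-asym a<c (proj₁ (image-inside-edge cd (pos<⇒≢ c<b) (≢-sym (pos<⇒≢ b<d))
                           (c<b , b<d) (edge-sym {G = image} ab) (pos<⇒≢ a<c) (pos<⇒≢ a<d)))

    contraction : {G : Graph W} → Hom G K ι → ∀ {D} → DiameterAtMost K D → IsDiamOPCompletion D G image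
    contraction {G} hom {D} diam = completion , (pos ∘ ι , ι-pos-injective , contraction-nonCrossing) , diameter
      where
        completion : IsCompletion G image
        completion a b ab = subst₂ (Edge image) (φι a) (φι b)
          (image⁺ (hom ab) λ φιa≡φιb → edge-irrefl {G = G} ab (trans (sym (φι a)) (trans φιa≡φιb (φι b))))

        ι-pos-injective : Injective (pos ∘ ι)
        ι-pos-injective a b eq = ι-injective a b (pos-inj _ _ eq)

        diameter : DiameterAtMost image D
        diameter a b = subst₂ (λ x y → DistAtMost image x y D) (φι a) (φι b) (image-dist (diam (ι a) (ι b)))

-- Centres

module Centre {V : Set} (search : Searchable V) (_≟_ : DecidableEquality V) (bounded : Bounded V)
  {pos : V → ℕ} (pos-inj : Injective pos) (K : ℕ) where

  CentredCompletion : Graph V → Set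
  CentredCompletion H =
    ∃ λ H′ → IsCompletion H H′ × NonCrossing H′ pos × ∃ λ w → ∀ y → DistAtMost H′ w y (suc K)

  centred-lift : ∀ {H H₁} → IsCompletion H H₁ → CentredCompletion H₁ → CentredCompletion H
  centred-lift {H} {H₁} H⊆H₁ (H′ , H₁⊆H′ , rest) =
    H′ , completion-trans {G = H} {H = H₁} {K = H′} H⊆H₁ H₁⊆H′ , rest

  Near : Graph V → V → V → V → Set
  Near H a b y = DistAtMost H a y K ⊎ DistAtMost H b y K

  near? : ∀ H a b y → Dec (Near H a b y)
  near? H a b y = dist? search _≟_ H K a y ⊎-dec dist? search _≟_ H K b y

  Guarded : Graph V → V → V → Set
  Guarded H a b = ∀ y → ¬ Inside pos a b y → Near H a b y

  near-completion : ∀ {H H₁ a b y} → IsCompletion H H₁ → Near H a b y → Near H₁ a b y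
  near-completion H⊆H₁ (inj₁ d) = inj₁ (completion-dist H⊆H₁ d)
  near-completion H⊆H₁ (inj₂ d) = inj₂ (completion-dist H⊆H₁ d)

  near⇒dist : ∀ {H z a b y} → z ≡ a ⊎ Edge H z a → z ≡ b ⊎ Edge H z b → Near H a b y →
              DistAtMost H z y (suc K)
  near⇒dist (inj₁ refl) _ (inj₁ d) = dist-mono (n≤1+n K) d
  near⇒dist (inj₂ za)   _ (inj₁ d) = dist-step za d
  near⇒dist _ (inj₁ refl) (inj₂ d) = dist-mono (n≤1+n K) d
  near⇒dist _ (inj₂ zb)   (inj₂ d) = dist-step zb d

  module _ {H : Graph V} (nc : NonCrossing H pos) where

    chord-exit : ∀ {a c x y l} → Edge H a c → Inside pos a c x → ¬ Inside pos a c y → Walk H x y l →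
           ∃ λ t → (t ≡ a ⊎ t ≡ c) × ∃₂ λ l₁ l₂ → l₁ + l₂ ≡ l × Walk H x t l₁ × Walk H t y l₂
    chord-exit ac i o here = ⊥-elim (o i)
    chord-exit {a} {c} ac i o (step {w = z} e p) with z ≟ a | z ≟ c
    ... | yes z≡a | _       = z , inj₁ z≡a , 1 , _ , refl , step e here , p
    ... | no _    | yes z≡c = z , inj₂ z≡c , 1 , _ , refl , step e here , p
    ... | no z≢a  | no z≢c with chord-exit ac (inside-edge {G = H} pos-inj nc ac i e z≢a z≢c) o p
    ...   | t , t∈ac , l₁ , l₂ , refl , p₁ , p₂ = t , t∈ac , suc l₁ , l₂ , refl , step e p₁ , p₂

    near-at : ∀ {a c t y} → t ≡ a ⊎ t ≡ c → DistAtMost H t y K → Near H a c y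
    near-at (inj₁ refl) = inj₁
    near-at (inj₂ refl) = inj₂

    -- A walk of length ≤ 2K + 1 from the far vertex x leaves the chord through an endpoint;
    -- the part before it is longer than K as x is far, so the rest has length at most K.
    far-inside⇒guarded : DiameterAtMost H (suc (K + K)) → ∀ {a c x} → Edge H a c → Inside pos a c x →
                         ¬ Near H a c x → Guarded H a c
    far-inside⇒guarded diam {x = x} ac i far y o with diam x y
    ... | l , l≤2K+1 , p with chord-exit ac i o p
    ...   | t , t∈ac , l₁ , l₂ , refl , p₁ , p₂ with l₁ ≤? K
    ...     | yes l₁≤K = ⊥-elim (far (near-at t∈ac (l₁ , l₁≤K , reverseʷ p₁)))
    ...     | no l₁≰K  =
      near-at t∈ac (l₂ , +-cancelˡ-≤ (suc K) l₂ K (≤-trans (+-monoˡ-≤ l₂ (≰⇒> l₁≰K)) l≤2K+1) , p₂)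

  inside? : ∀ a b x → Dec (Inside pos a b x)
  inside? a b x = pos a <? pos x ×-dec pos x <? pos b

  Far : Graph V → V → V → Set
  Far H a b = ∃ λ y → Inside pos a b y × ¬ Near H a b y

  far? : ∀ H a b → Dec (Far H a b)
  far? H a b = search λ y → inside? a b y ×-dec ¬? (near? H a b y)

  ¬far⇒near : ∀ {H a b y} → ¬ Far H a b → Inside pos a b y → Near H a b y
  ¬far⇒near {H} {a} {b} {y} ¬far y-in with near? H a b y
  ... | yes near = near
  ... | no ¬near = ⊥-elim (¬far (y , y-in , ¬near))

  TriangleOn : Graph V → V → V → Set
  TriangleOn H a b =
    ∃ λ H′ → IsCompletion H H′ × NonCrossing H′ pos ×
             ∃ λ c → Inside pos a b c × Edge H′ a c × Edge H′ c b

  module _ {H : Graph V} (nc : NonCrossing H pos) {a b : V} (ab : Edge H a b) where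

    attach-leftmost : ∀ {y} → Inside pos a b y →
                   ∃ λ H′ → IsCompletion H H′ × NonCrossing H′ pos × ∃ λ m → Inside pos a b m × Edge H′ a m
    attach-leftmost y-in with Extremum.minimal search (inside? a b) pos y-in
    ... | m , m-in@(a<m , m<b) , m-min =
      A.graph , A.completion , A.nonCrossing nc a<m free free′ , m , m-in , A.added
      where
        module A = AddEdge _≟_ H (pos<⇒≢ {pos = pos} a<m)
        free : ∀ x y → Edge H x y → ¬ Crossing pos a m x y
        free x y _ (a<x , x<m , _) = <⇒≱ x<m (m-min x (a<x , <-trans x<m m<b))
        free′ : ∀ x y → Edge H x y → ¬ Crossing pos x y a m
        free′ x y _ (_ , a<y , y<m) = <⇒≱ y<m (m-min y (a<y , <-trans y<m m<b))

    close-triangle : ∀ {m} → Inside pos a b m → Edge H a m → TriangleOn H a b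
    close-triangle m-in am
      with Extremum.maximal search (λ x → inside? a b x ×-dec edge? {G = H} a x) pos (proj₂ (bounded pos)) (m-in , am)
    ... | c , (c-in@(a<c , c<b) , ac) , c-max =
      A.graph , A.completion , A.nonCrossing nc c<b free free′ , c , c-in , A.completion a c ac , A.added
      where
        module A = AddEdge _≟_ H (pos<⇒≢ {pos = pos} c<b)
        free : ∀ x y → Edge H x y → ¬ Crossing pos c b x y
        free x y xy (c<x , x<b , b<y) = nc a b x y ab xy (<-trans a<c c<x , x<b , b<y)
        free′ : ∀ x y → Edge H x y → ¬ Crossing pos x y c b
        free′ x y xy (x<c , c<y , y<b) with <-cmp (pos x) (pos a)
        ... | tri< x<a _ _ = nc x y a b xy ab (x<a , <-trans a<c c<y , y<b)
        ... | tri≈ _ x≡a _ rewrite pos-inj x a x≡a = <⇒≱ c<y (c-max y ((<-trans a<c c<y , y<b) , xy))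
        ... | tri> _ _ a<x = nc a c x y ac xy (a<x , x<c , c<y)

  triangle : ∀ {H} → NonCrossing H pos → ∀ {a b y} → Edge H a b → Inside pos a b y → TriangleOn H a b
  triangle {H} nc {a} {b} ab y-in with attach-leftmost {H} nc {a} {b} ab y-in
  ... | H₁ , H⊆H₁ , nc₁ , m , m-in , am with close-triangle {H₁} nc₁ {a} {b} (H⊆H₁ a b ab) m-in am
  ...   | H₂ , H₁⊆H₂ , rest = H₂ , completion-trans {G = H} {H = H₁} {K = H₂} H⊆H₁ H₁⊆H₂ , rest

  apex-centre : ∀ {H a b c} → Edge H a c → Edge H c b → Guarded H a b → ¬ Far H a c → ¬ Far H c b →
                ∀ y → DistAtMost H c y (suc K)
  apex-centre {H} {a} {b} {c} ac cb guarded ¬far-ac ¬far-cb y with inside? a b y | <-cmp (pos y) (pos c)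
  ... | no y-out        | _ = near⇒dist (inj₂ ca) (inj₂ cb) (guarded y y-out)
    where ca = edge-sym {G = H} ac
  ... | yes _           | tri≈ _ y≡c _ rewrite pos-inj y c y≡c = dist-refl
  ... | yes (a<y , _)   | tri< y<c _ _ = near⇒dist (inj₂ ca) (inj₁ refl) (¬far⇒near ¬far-ac (a<y , y<c))
    where ca = edge-sym {G = H} ac
  ... | yes (_ , y<b)   | tri> _ _ c<y = near⇒dist (inj₁ refl) (inj₂ cb) (¬far⇒near ¬far-cb (c<y , y<b))

  -- Close a triangle abc on the chord.  If a vertex inside ac (or cb) is far from both ends of
  -- that side, everything outside the side is near its ends and we descend into it; otherwise
  -- c is a centre.
  centred-chord : ∀ fuel {H a b} → NonCrossing H pos → DiameterAtMost H (suc (K + K)) →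
                  Edge H a b → pos a < pos b → pos b ≤ pos a + fuel → Guarded H a b → CentredCompletion H
  centred-chord zero {a = a} _ _ _ a<b b≤a+0 _ =
    ⊥-elim (<⇒≱ a<b (≤-trans b≤a+0 (≤-reflexive (+-identityʳ (pos a)))))
  centred-chord (suc fuel) {H} {a} {b} nc diam ab a<b b≤a+fuel guarded with search (inside? a b)
  ... | no empty =
    H , completion-refl {G = H} , nc , a , λ y → near⇒dist (inj₁ refl) (inj₂ ab) (guarded y λ i → empty (y , i))
  ... | yes (_ , y-in) with triangle {H} nc {a} {b} ab y-in
  ...   | H′ , H⊆H′ , nc′ , c , (a<c , c<b) , ac , cb with far? H′ a c | far? H′ c b
  ...     | yes (x , x-in , x-far) | _ =
    centred-lift {H} {H′} H⊆H′
      (centred-chord fuel nc′ diam′ ac a<c c≤a+fuel (far-inside⇒guarded {H′} nc′ diam′ {a} {c} ac x-in x-far))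
    where
      diam′ = diameter-completion H⊆H′ diam
      c≤a+fuel : pos c ≤ pos a + fuel
      c≤a+fuel = ≤-pred (≤-trans (<-≤-trans c<b b≤a+fuel) (≤-reflexive (+-suc (pos a) fuel)))
  ...     | no _ | yes (x , x-in , x-far) =
    centred-lift {H} {H′} H⊆H′
      (centred-chord fuel nc′ diam′ cb c<b b≤c+fuel (far-inside⇒guarded {H′} nc′ diam′ {c} {b} cb x-in x-far))
    where
      diam′ = diameter-completion H⊆H′ diam
      b≤c+fuel : pos b ≤ pos c + fuel
      b≤c+fuel = ≤-trans b≤a+fuel (≤-trans (≤-reflexive (+-suc (pos a) fuel)) (+-monoˡ-≤ fuel a<c))
  ...     | no ¬far-ac | no ¬far-cb =
    H′ , H⊆H′ , nc′ , c ,
    apex-centre {H′} ac cb (λ y y-out → near-completion H⊆H′ (guarded y y-out)) ¬far-ac ¬far-cb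

  centre : ∀ {H} → NonCrossing H pos → DiameterAtMost H (suc (K + K)) → V → CentredCompletion H
  centre {H} nc diam x with minimal pos {x} tt | maximal pos (proj₂ (bounded pos)) {x} tt
    where open Extremum search {P = λ _ → ⊤} (λ _ → yes tt)
  ... | m , _ , m-min | M , _ , M-max with pos m <? pos M
  ...   | yes m<M = centred-lift {H} {A.graph} A.completion
                      (centred-chord (pos M) ncA (diameter-completion A.completion diam) A.added m<M (m≤n+m _ _) guarded)
    where
      module A = AddEdge _≟_ H (pos<⇒≢ {pos = pos} m<M)
      ncA : NonCrossing A.graph pos
      ncA = A.nonCrossing nc m<M (λ x y _ cr → <⇒≱ (proj₂ (proj₂ cr)) (M-max y tt))
                                 (λ x y _ cr → <⇒≱ (proj₁ cr) (m-min x tt))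
      guarded : Guarded A.graph m M
      guarded y y-out with m≤n⇒m<n∨m≡n (m-min y tt) | m≤n⇒m<n∨m≡n (M-max y tt)
      ... | inj₂ m≡y | _        rewrite pos-inj m y m≡y = inj₁ dist-refl
      ... | inj₁ _   | inj₂ y≡M rewrite pos-inj y M y≡M = inj₂ dist-refl
      ... | inj₁ m<y | inj₁ y<M = ⊥-elim (y-out (m<y , y<M))
  ...   | no m≮M =
    H , completion-refl {G = H} , nc , m , λ y → subst (λ v → DistAtMost H m v (suc K)) (all≡m y) dist-refl
    where
      all≡m : ∀ y → m ≡ y
      all≡m y = pos-inj m y (≤-antisym (m-min y tt) (≤-trans (M-max y tt) (≮⇒≥ m≮M)))

-- Gluing

module Rotation {V : Set} {G : Graph V} {pos : V → ℕ} (pos-inj : Injective pos) (nc : NonCrossing G pos)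
  {P : ℕ} (pos<P : ∀ x → pos x < P) (v : V) where

  private
    shift : ∀ x → Dec (pos v ≤ pos x) → ℕ
    shift x (yes _) = pos x ∸ pos v
    shift x (no _)  = pos x + P ∸ pos v

  rotated : V → ℕ
  rotated x = shift x (pos v ≤? pos x)

  data Arc (x : V) (r : ℕ) : Set where
    after  : pos v ≤ pos x → r + pos v ≡ pos x     → Arc x r
    before : pos x < pos v → r + pos v ≡ pos x + P → Arc x r

  arc : ∀ x → Arc x (rotated x)
  arc x = arc-shift (pos v ≤? pos x)
    where
      arc-shift : (v≤x? : Dec (pos v ≤ pos x)) → Arc x (shift x v≤x?)
      arc-shift (yes v≤x) = after v≤x (m∸n+n≡m v≤x)
      arc-shift (no v≰x)  = before (≰⇒> v≰x) (m∸n+n≡m (≤-trans (<⇒≤ (pos<P v)) (m≤n+m P (pos x))))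

  private
    after-mono : ∀ {x y} → rotated x + pos v ≡ pos x → rotated y + pos v ≡ pos y →
                 rotated x < rotated y → pos x < pos y
    after-mono ex ey x<y = subst₂ _<_ ex ey (+-monoˡ-< (pos v) x<y)

    before-mono : ∀ {x y} → rotated x + pos v ≡ pos x + P → rotated y + pos v ≡ pos y + P →
                  rotated x < rotated y → pos x < pos y
    before-mono {x} {y} ex ey x<y = +-cancelʳ-< P (pos x) (pos y) (subst₂ _<_ ex ey (+-monoˡ-< (pos v) x<y))

    after<before : ∀ {x y} → rotated x + pos v ≡ pos x → rotated y + pos v ≡ pos y + P → rotated x < rotated y
    after<before {x} {y} ex ey =
      +-cancelʳ-< (pos v) _ _ (subst₂ _<_ (sym ex) (sym ey) (<-≤-trans (pos<P x) (m≤n+m P (pos y))))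

    no-wrap : ∀ {x y} → Arc x (rotated x) → Arc y (rotated y) → pos x < pos v → pos v ≤ pos y →
              ¬ rotated x < rotated y
    no-wrap (before _ ex) (after _ ey) _ _ x<y = <-asym x<y (after<before ey ex)
    no-wrap (after v≤x _) _ x<v _ _ = <⇒≱ x<v v≤x
    no-wrap _ (before y<v _) _ v≤y _ = <⇒≱ y<v v≤y

  rotated-nonCrossing : NonCrossing G rotated
  rotated-nonCrossing a b c d ab cd (a<c , c<b , b<d) = go (arc a) (arc c) (arc b) (arc d)
    where
      ba = edge-sym {G = G} ab
      dc = edge-sym {G = G} cd
      -- All `after` vertices precede all `before` ones in the rotated order, so the endpoints
      -- form a cyclic shift of a crossing in the original order.
      go : Arc a (rotated a) → Arc c (rotated c) → Arc b (rotated b) → Arc d (rotated d) → ⊥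
      go va@(before a<v _) vc@(after v≤c _) _ _ = no-wrap va vc a<v v≤c a<c
      go _ vc@(before c<v _) vb@(after v≤b _) _ = no-wrap vc vb c<v v≤b c<b
      go _ _ vb@(before b<v _) vd@(after v≤d _) = no-wrap vb vd b<v v≤d b<d
      go (after _ ea) (after _ ec) (after _ eb) (after _ ed) =
        nc a b c d ab cd (after-mono ea ec a<c , after-mono ec eb c<b , after-mono eb ed b<d)
      go (before _ ea) (before _ ec) (before _ eb) (before _ ed) =
        nc a b c d ab cd (before-mono ea ec a<c , before-mono ec eb c<b , before-mono eb ed b<d)
      go (after v≤a _) (before _ ec) (before _ eb) (before d<v ed) =
        nc c d b a cd ba (before-mono ec eb c<b , before-mono eb ed b<d , <-≤-trans d<v v≤a)
      go (after v≤a ea) (after _ ec) (before _ eb) (before d<v ed) =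
        nc b a d c ba dc (before-mono eb ed b<d , <-≤-trans d<v v≤a , after-mono ea ec a<c)
      go (after v≤a ea) (after _ ec) (after _ eb) (before d<v _) =
        nc d c a b dc ab (<-≤-trans d<v v≤a , after-mono ea ec a<c , after-mono ec eb c<b)

  rotated-injective : Injective rotated
  rotated-injective x y eq with arc x | arc y
  ... | after _ ex  | after _ ey  = pos-inj x y (trans (sym ex) (trans (cong (_+ pos v) eq) ey))
  ... | before _ ex | before _ ey =
    pos-inj x y (+-cancelʳ-≡ P (pos x) (pos y) (trans (sym ex) (trans (cong (_+ pos v) eq) ey)))
  ... | after _ ex  | before _ ey = ⊥-elim (<-irrefl eq (after<before ex ey))
  ... | before _ ex | after _ ey  = ⊥-elim (<-irrefl (sym eq) (after<before ey ex))

  rotated<P : ∀ x → rotated x < P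
  rotated<P x with arc x
  ... | after _ ex = ≤-<-trans (m≤m+n (rotated x) (pos v)) (subst (_< P) (sym ex) (pos<P x))
  ... | before x<v ex =
    +-cancelʳ-< (pos v) (rotated x) P (subst₂ _<_ (sym ex) (+-comm (pos v) P) (+-monoˡ-< P x<v))

  rotated-v : rotated v ≡ 0
  rotated-v with arc v
  ... | after _ ev    = +-cancelʳ-≡ (pos v) (rotated v) 0 ev
  ... | before v<v _  = ⊥-elim (<-irrefl refl v<v)

module Glue {C B T : Set} (search : Searchable (Maybe C ⊎ B)) (_≟_ : DecidableEquality T)
  (Cs : Graph (Maybe C)) (H : Graph B) (w : B)
  (ψ : Maybe C ⊎ B → T) (ψ-glue : ψ (inj₁ nothing) ≡ ψ (inj₂ w))
  (split : T → Maybe C ⊎ B) (ψ-split : ∀ t → ψ (split t) ≡ t)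
  (split-ψ : ∀ x → split (ψ x) ≡ x ⊎ (x ≡ inj₁ nothing × split (ψ x) ≡ inj₂ w)) where

  open Image search _≟_ (Cs ⊕ H) ψ public using (image; image⁺; image-dist)
  open Image search _≟_ (Cs ⊕ H) ψ using (image-nonCrossing)

  module _ {D r E : ℕ} (r+E≤D : r + E ≤ D) (Cs-diam : DiameterAtMost Cs D) (H-diam : DiameterAtMost H D)
    (Cs-ecc : ∀ m → DistAtMost Cs nothing m r) (H-ecc : ∀ b → DistAtMost H w b E) where

    private
      dist₁ : ∀ {m m′ k} → DistAtMost Cs m m′ k → DistAtMost image (ψ (inj₁ m)) (ψ (inj₁ m′)) k
      dist₁ = image-dist ∘ dist-hom {G = Cs} {H = Cs ⊕ H} id

      dist₂ : ∀ {b b′ k} → DistAtMost H b b′ k → DistAtMost image (ψ (inj₂ b)) (ψ (inj₂ b′)) k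
      dist₂ = image-dist ∘ dist-hom {G = H} {H = Cs ⊕ H} id

      across : ∀ m b → DistAtMost image (ψ (inj₁ m)) (ψ (inj₂ b)) D
      across m b = dist-mono r+E≤D (dist-trans (dist₁ (dist-sym (Cs-ecc m)))
                                   (subst (λ t → DistAtMost image t (ψ (inj₂ b)) E) (sym ψ-glue) (dist₂ (H-ecc b))))

      diameter′ : ∀ x y → DistAtMost image (ψ x) (ψ y) D
      diameter′ (inj₁ m) (inj₁ m′) = dist₁ (Cs-diam m m′)
      diameter′ (inj₂ b) (inj₂ b′) = dist₂ (H-diam b b′)
      diameter′ (inj₁ m) (inj₂ b)  = across m b
      diameter′ (inj₂ b) (inj₁ m)  = dist-sym (across m b)

    glued-diameter : DiameterAtMost image D
    glued-diameter t t′ =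
      subst₂ (λ u u′ → DistAtMost image u u′ D) (ψ-split t) (ψ-split t′) (diameter′ (split t) (split t′))

  module _ {pc : Maybe C → ℕ} (pc-inj : Injective pc) (Cs-nc : NonCrossing Cs pc) (pc-v : pc nothing ≡ 0)
    {Q : ℕ} (pc<Q : ∀ m → pc m < Q) {pb : B → ℕ} (pb-inj : Injective pb) (H-nc : NonCrossing H pb) where

    base : B → ℕ
    base b = suc Q * pb b

    -- H is spread out by the factor Q + 1 and C*, rotated to start at v, fills the gap after w,
    -- with v on the slot of w.
    slot : Maybe C ⊎ B → ℕ
    slot (inj₁ m) = base w + pc m
    slot (inj₂ b) = base b

    private
      gap : ∀ b → base w < base b → ¬ base b < base w + Q
      gap b w<b b<w+Q = <-asym b<w+Q (begin
        suc (base w + Q)         ≡⟨ +-suc (base w) Q ⟨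
        base w + suc Q           ≡⟨ +-comm (base w) (suc Q) ⟩
        suc Q + base w           ≡⟨ *-suc (suc Q) (pb w) ⟨
        suc Q * suc (pb w)       ≤⟨ *-monoʳ-≤ (suc Q) (*-cancelˡ-< (suc Q) (pb w) (pb b) w<b) ⟩
        base b                   ∎)
        where open ≤-Reasoning

      slot₁-bounds : ∀ m → base w ≤ slot (inj₁ m) × slot (inj₁ m) < base w + Q
      slot₁-bounds m = m≤m+n (base w) (pc m) , +-monoʳ-< (base w) (pc<Q m)

      slot-nonCrossing : NonCrossing (Cs ⊕ H) slot
      slot-nonCrossing (inj₁ m) (inj₁ m′) (inj₁ n) (inj₁ n′) e e′ (l₁ , l₂ , l₃) =
        Cs-nc m m′ n n′ e e′ (+-cancelˡ-< (base w) _ _ l₁ , +-cancelˡ-< (base w) _ _ l₂ ,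
                              +-cancelˡ-< (base w) _ _ l₃)
      slot-nonCrossing (inj₂ b) (inj₂ b′) (inj₂ c) (inj₂ c′) e e′ (l₁ , l₂ , l₃) =
        H-nc b b′ c c′ e e′ (*-cancelˡ-< (suc Q) _ _ l₁ , *-cancelˡ-< (suc Q) _ _ l₂ ,
                             *-cancelˡ-< (suc Q) _ _ l₃)
      slot-nonCrossing (inj₂ _) (inj₂ b′) (inj₁ n) (inj₁ n′) _ _ (_ , l₂ , l₃) =
        gap b′ (≤-<-trans (proj₁ (slot₁-bounds n)) l₂) (<-trans l₃ (proj₂ (slot₁-bounds n′)))
      slot-nonCrossing (inj₁ m) (inj₁ m′) (inj₂ c) (inj₂ _) _ _ (l₁ , l₂ , _) =
        gap c (≤-<-trans (proj₁ (slot₁-bounds m)) l₁) (<-trans l₂ (proj₂ (slot₁-bounds m′)))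
      slot-nonCrossing (inj₁ _) (inj₂ _) _ _ () _ _
      slot-nonCrossing (inj₂ _) (inj₁ _) _ _ () _ _
      slot-nonCrossing (inj₁ _) (inj₁ _) (inj₁ _) (inj₂ _) _ () _
      slot-nonCrossing (inj₁ _) (inj₁ _) (inj₂ _) (inj₁ _) _ () _
      slot-nonCrossing (inj₂ _) (inj₂ _) (inj₁ _) (inj₂ _) _ () _
      slot-nonCrossing (inj₂ _) (inj₂ _) (inj₂ _) (inj₁ _) _ () _

      slot-v : slot (inj₁ nothing) ≡ base w
      slot-v = trans (cong (base w +_) pc-v) (+-identityʳ (base w))

      slot-mixed : ∀ m b → slot (inj₁ m) ≡ slot (inj₂ b) → ψ (inj₁ m) ≡ ψ (inj₂ b)
      slot-mixed nothing b eq =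
        trans ψ-glue (cong (ψ ∘ inj₂) (pb-inj w b (*-cancelˡ-≡ (pb w) (pb b) (suc Q) (trans (sym slot-v) eq))))
      slot-mixed (just c) b eq =
        ⊥-elim (gap b (subst (base w <_) eq w<c) (subst (_< base w + Q) eq (proj₂ (slot₁-bounds (just c)))))
        where
          w<c : base w < slot (inj₁ (just c))
          w<c = subst (_< slot (inj₁ (just c))) (+-identityʳ (base w))
                  (+-monoʳ-< (base w) (n≢0⇒n>0 λ pc≡0 →
                    case pc-inj (just c) nothing (trans pc≡0 (sym pc-v)) of λ ()))

      slot-glued : ∀ x y → slot x ≡ slot y → ψ x ≡ ψ y
      slot-glued (inj₁ m) (inj₁ m′) eq = cong (ψ ∘ inj₁) (pc-inj m m′ (+-cancelˡ-≡ (base w) _ _ eq))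
      slot-glued (inj₂ b) (inj₂ b′) eq = cong (ψ ∘ inj₂) (pb-inj b b′ (*-cancelˡ-≡ (pb b) (pb b′) (suc Q) eq))
      slot-glued (inj₁ m) (inj₂ b) eq  = slot-mixed m b eq
      slot-glued (inj₂ b) (inj₁ m) eq  = sym (slot-mixed m b (sym eq))

      slot-split-ψ : ∀ x → slot x ≡ slot (split (ψ x))
      slot-split-ψ x with split-ψ x
      ... | inj₁ split-ψx≡x      = cong slot (sym split-ψx≡x)
      ... | inj₂ (refl , split-ψx≡w) = trans slot-v (cong slot (sym split-ψx≡w))

    glued-outerplanar : Outerplanar image
    glued-outerplanar =
      slot ∘ split ,
      (λ t t′ eq → trans (sym (ψ-split t)) (trans (slot-glued _ _ eq) (ψ-split t′))) ,
      image-nonCrossing (nonCrossing-resp {G = Cs ⊕ H} slot-split-ψ slot-nonCrossing)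

radius-split : ∀ {r D} → 2 * r < D → ∃ λ K → r + suc K ≤ D × D ≤ suc (K + K)
radius-split {r} {D} 2r<D = K , ≤-reflexive r+1+K≡D , D≤1+K+K
  where
    K = D ∸ suc r

    r+1+K≡D : r + suc K ≡ D
    r+1+K≡D = trans (+-suc r K) (m+[n∸m]≡n (≤-<-trans (m≤m+n r (r + 0)) 2r<D))

    r≤K : r ≤ K
    r≤K = ≤-pred (subst (_< suc K) (+-identityʳ r)
                   (+-cancelˡ-< r (r + 0) (suc K) (<-≤-trans 2r<D (≤-reflexive (sym r+1+K≡D)))))

    D≤1+K+K : D ≤ suc (K + K)
    D≤1+K+K = ≤-trans (≤-reflexive (trans (sym r+1+K≡D) (+-suc r K))) (s≤s (+-monoˡ-≤ K r≤K))

module Parts {n : ℕ} (S : Fin n → Bool) where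

  Part : Bool → Set
  Part b = Σ (Fin n) λ i → S i ≡ b

  part-≡ : ∀ {b} {x y : Part b} → proj₁ x ≡ proj₁ y → x ≡ y
  part-≡ {x = i , e} {.i , e′} refl = cong (i ,_) (uip e e′)

  _≟ₚ_ : ∀ {b} → DecidableEquality (Part b)
  x ≟ₚ y = map′ part-≡ (cong proj₁) (proj₁ x Fin.≟ proj₁ y)

  searchable-Part : ∀ b → Searchable (Part b)
  searchable-Part = searchable-fibre Fin.any? S

  bounded-Part : ∀ b → Bounded (Part b)
  bounded-Part = bounded-fibre bounded-Fin S

  classify : Fin n → Part true ⊎ Part false
  classify i = Sum.map (i ,_) (i ,_) (true-or-false (S i))

  classify-true : (c : Part true) → classify (proj₁ c) ≡ inj₁ c
  classify-true (i , e) with true-or-false (S i)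
  ... | inj₁ _  = cong inj₁ (part-≡ refl)
  ... | inj₂ e′ = ⊥-elim (true≢false (trans (sym e) e′))

  classify-false : (b : Part false) → classify (proj₁ b) ≡ inj₂ b
  classify-false (i , e) with true-or-false (S i)
  ... | inj₁ e′ = ⊥-elim (true≢false (trans (sym e′) e))
  ... | inj₂ _  = cong inj₂ (part-≡ refl)

module _ {n : ℕ} (G : Graph (Fin n)) (S : Fin n → Bool)
  (closed : ∀ u v → Edge G u v → S u ≡ true → S v ≡ true) where
  open Parts S

  removal : ∀ {D} → (∀ u v → S u ≡ true → S v ≡ true → ∃ (Walk G u v)) → Part true →
            HasDiamOPCompletion D G → HasDiamOPCompletion D (InducedOn G S false)
  removal connected (c₀ , Sc₀) (G′ , G⊆G′ , (pos , pos-inj , nc) , diam)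
    with searchable-Part false {λ _ → ⊤} (λ _ → yes tt)
  ... | no empty =
    InducedOn G S false , completion-refl {G = InducedOn G S false} , ((λ _ → 0) , none , none) , none
    where
      none : {A : Part false → Set} → (b : Part false) → A b
      none b = ⊥-elim (empty (b , tt))
  ... | yes ((b₀ , Sb₀) , _) with walk-exit S (proj₂ (proj₂ (diam c₀ b₀))) Sc₀ Sb₀
  ...   | x , y , Sx , Sy , xy =
    image , contraction retract {G = InducedOn G S false} (λ {a} {b} → G⊆G′ (proj₁ a) (proj₁ b)) diam
    where
      u : Part false
      u = y , Sy

      φ : Fin n → Part false
      φ = [ (λ _ → u) , id ]′ ∘ classify

      open Contraction Fin.any? _≟ₚ_ G′ pos-inj nc proj₁ φ (cong [ (λ _ → u) , id ]′ ∘ classify-false) u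

      off : ∀ {z} → S z ≡ true → OffImage z
      off Sz (_ , S≡false) refl = true≢false (trans (sym Sz) S≡false)

      reaches : ∀ {z l} → Walk G z x l → S z ≡ true → Reaches z
      reaches here       Sz = via (off Sz) xy arrived
      reaches (step e p) Sz = via (off Sz) (G⊆G′ _ _ e) (reaches p (closed _ _ e Sz))

      retract : ∀ z → proj₁ (φ z) ≡ z ⊎ (φ z ≡ u × Reaches z)
      retract z with true-or-false (S z)
      ... | inj₁ Sz = inj₂ (refl , reaches (proj₂ (connected z x Sz Sx)) Sz)
      ... | inj₂ _  = inj₁ refl

  absorb-new-vertex : ∀ {D r} → (∀ i → S i ≡ true) → Part true → EscEccAtMost D (InducedOn G S true) r →
                      HasDiamOPCompletion D G
  absorb-new-vertex all-C c₀ (Cs , (C⊆Cs , (pos , pos-inj , nc) , diam) , _)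
    with walk-first-edge (proj₂ (proj₂ (diam nothing (just c₀)))) (λ ())
  ... | nothing , e = ⊥-elim (edge-irrefl {G = Cs} e refl)
  ... | just c₁ , e = image , contraction retract {G = G} (λ {i} {j} → C⊆Cs (ι i) (ι j)) diam
    where
      ι : Fin n → Maybe (Part true)
      ι i = just (i , all-C i)

      φ : Maybe (Part true) → Fin n
      φ (just c) = proj₁ c
      φ nothing  = proj₁ c₁

      open Contraction (searchable-Maybe (searchable-Part true)) Fin._≟_ Cs pos-inj nc ι φ (λ _ → refl) (proj₁ c₁)

      retract : ∀ x → ι (φ x) ≡ x ⊎ (φ x ≡ proj₁ c₁ × Reaches x)
      retract (just c) = inj₁ (cong just (part-≡ refl))
      retract nothing  = inj₂ (refl , via (λ _ ()) e (subst Reaches (cong just (part-≡ refl)) arrived))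

  graft : ∀ {D r} → 2 * r < D → Part false → EscEccAtMost D (InducedOn G S true) r →
          HasDiamOPCompletion D (InducedOn G S false) → HasDiamOPCompletion D G
  graft 2r<D b₀ (Cs , (C⊆Cs , (pc , pc-inj , Cs-nc) , Cs-diam) , Cs-ecc) (H , B⊆H , (pb , pb-inj , H-nc) , H-diam)
    with radius-split 2r<D
  ... | K , r+1+K≤D , D≤1+K+K with centre H-nc (diameter-mono D≤1+K+K H-diam) b₀
    where open Centre (searchable-Part false) _≟ₚ_ (bounded-Part false) pb-inj K
  ... | H′ , H⊆H′ , H′-nc , w , H′-ecc =
    image , completion ,
    glued-outerplanar rotated-injective rotated-nonCrossing rotated-v rotated<P pb-inj H′-nc ,
    glued-diameter r+1+K≤D Cs-diam (diameter-completion H⊆H′ H-diam) Cs-ecc H′-ecc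
    where
      ψ : Maybe (Part true) ⊎ Part false → Fin n
      ψ (inj₁ (just c)) = proj₁ c
      ψ (inj₁ nothing)  = proj₁ w
      ψ (inj₂ b)        = proj₁ b

      split : Fin n → Maybe (Part true) ⊎ Part false
      split = Sum.map₁ just ∘ classify

      ψ-split : ∀ i → ψ (split i) ≡ i
      ψ-split i with true-or-false (S i)
      ... | inj₁ _ = refl
      ... | inj₂ _ = refl

      split-ψ : ∀ x → split (ψ x) ≡ x ⊎ (x ≡ inj₁ nothing × split (ψ x) ≡ inj₂ w)
      split-ψ (inj₁ (just c)) = inj₁ (cong (Sum.map₁ just) (classify-true c))
      split-ψ (inj₁ nothing)  = inj₂ (refl , cong (Sum.map₁ just) (classify-false w))
      split-ψ (inj₂ b)        = inj₁ (cong (Sum.map₁ just) (classify-false b))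

      open Rotation {G = Cs} pc-inj Cs-nc (proj₂ (bounded-Maybe (bounded-Part true) pc)) nothing
      open Glue (searchable-⊎ (searchable-Maybe (searchable-Part true)) (searchable-Part false)) Fin._≟_
                Cs H′ w ψ refl split ψ-split split-ψ

      completion : IsCompletion G image
      completion i j e with true-or-false (S i) | true-or-false (S j)
      ... | inj₁ Si | inj₁ Sj = image⁺ {inj₁ (just (i , Si))} {inj₁ (just (j , Sj))}
                                  (C⊆Cs (just (i , Si)) (just (j , Sj)) e) (edge-irrefl {G = G} e)
      ... | inj₂ Si | inj₂ Sj = image⁺ {inj₂ (i , Si)} {inj₂ (j , Sj)}
                                  (H⊆H′ (i , Si) (j , Sj) (B⊆H (i , Si) (j , Sj) e)) (edge-irrefl {G = G} e)
      ... | inj₁ Si | inj₂ Sj = ⊥-elim (true≢false (trans (sym (closed i j e Si)) Sj))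
      ... | inj₂ Si | inj₁ Sj = ⊥-elim (true≢false (trans (sym (closed j i (edge-sym {G = G} e) Sj)) Si))

  insertion : ∀ {D r} → 2 * r < D → Part true → EscEccAtMost D (InducedOn G S true) r →
              HasDiamOPCompletion D (InducedOn G S false) → HasDiamOPCompletion D G
  insertion 2r<D c₀ C-completion H-completion with searchable-Part false {λ _ → ⊤} (λ _ → yes tt)
  ... | yes (b₀ , _) = graft 2r<D b₀ C-completion H-completion
  ... | no empty     = absorb-new-vertex all-C c₀ C-completion
    where
      all-C : ∀ i → S i ≡ true
      all-C i with true-or-false (S i)
      ... | inj₁ Si = Si
      ... | inj₂ Si = ⊥-elim (empty ((i , Si) , tt))

lemma5 : (D : ℕ) → 1 ≤ D → (n : ℕ) → (G : Graph (Fin n)) → Outerplanar G →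
    (S : Fin n → Bool) → IsComponent G S →
    EscEccLtHalf D (InducedOn G S true) →
    (HasDiamOPCompletion D G → HasDiamOPCompletion D (InducedOn G S false)) ×
    (HasDiamOPCompletion D (InducedOn G S false) → HasDiamOPCompletion D G)
lemma5 D _ n G _ S (c₀ , connected , closed) (r , 2r<D , C-completion) =
  removal G S closed connected c₀ , insertion G S closed 2r<D c₀ C-completion
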